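{- Let $G=(V,E)$ be a finite undirected graph with binary edge weights $w:E\to\{0,1\}$. The solution $(x,y)$ returned by algorithm ForestCoverBinary on $G$ is a feasible solution of the integer program: $\min \sum_{u\in V}x_u-\sum_{e\in E}y_e(1-w_e)$ subject to $x_u+x_v\ge 1$ for every $e=(u,v)\in E$; $x_u-y_e\ge 0$ and $x_v-y_e\ge 0$ for every $e=(u,v)\in E$; $\sum_{u\in S}x_u-\sum_{e\in E(S)}y_e\ge 1$ for every $S\subseteq V$ with $E(S)\ne\emptyset$; $x_u,y_e\in\{0,1\}$.
   Context: $E(S)$ is the set of edges with both endpoints in $S$. Algorithm ForestCoverBinary: let $E_0$ be the set of weight-$0$ edges, $V_0$ the set of vertices incident to an edge of $E_0$, $V_1=V\setminus V_0$. Let $C_1,\dots,C_k$ be the connected components of $G_0=(V_0,E_0)$ and for each $C_i$ choose a spanning tree $T_i$ (with $|C_i|-1$ edges). Set $x_u=1$ for every $u\in\bigcup_i C_i$ and $y_e=1$ for every edge $e\in\bigcup_i T_i$. Find a maximum cardinality matching $M$ in $G_1=(V_1,E_1(V_1))$, where $E_1(V_1)$ is the set of edges of $G$ with both endpoints in $V_1$; for each $e=(u,v)\in M$ set $x_u=x_v=1$ and $y_e=1$. All other variables $x_u$, $y_e$ are set to $0$. -}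

module Defs where

open import Data.Nat using (ℕ; zero; suc; _+_; _≤_)
open import Data.Bool using (Bool; true; false; _∧_; _∨_; if_then_else_; not)
open import Data.Fin using (Fin; zero; suc; _≟_)
open import Data.Fin.Subset using (Subset; _∈_; _∩_; ∣_∣; Nonempty)
open import Data.Product using (_×_; _,_; proj₁; proj₂; ∃)
open import Data.Sum using (_⊎_)
open import Data.Vec using (lookup; tabulate)
open import Data.List using (allFin)
open import Data.Bool.ListAction using (any)
open import Relation.Nullary using (¬_; does)
open import Relation.Binary.PropositionalEquality using (_≡_; _≢_)

sumFin : ∀ {n} → (Fin n → ℕ) → ℕ
sumFin {zero}  f = 0
sumFin {suc n} f = f zero + sumFin (λ i → f (suc i))

-- A finite simple undirected graph on vertex set Fin n with edge set Fin m.
-- Edge e has endpoints (src e, tgt e) (orientation is irrelevant);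
-- no loops, no parallel edges.
record Graph : Set where
  field
    n     : ℕ
    m     : ℕ
    ends  : Fin m → Fin n × Fin n
    noLoop : ∀ e → proj₁ (ends e) ≢ proj₂ (ends e)
    simple : ∀ e e' →
      ((proj₁ (ends e) ≡ proj₁ (ends e') × proj₂ (ends e) ≡ proj₂ (ends e'))
       ⊎ (proj₁ (ends e) ≡ proj₂ (ends e') × proj₂ (ends e) ≡ proj₁ (ends e'))) →
      e ≡ e'

module _ (G : Graph) where
  open Graph G

  src tgt : Fin m → Fin n
  src e = proj₁ (ends e)
  tgt e = proj₂ (ends e)

  incident : Fin m → Fin n → Bool
  incident e u = does (src e ≟ u) ∨ does (tgt e ≟ u)

  data Walk (P : Fin m → Set) : Fin n → Fin n → Set where
    here : ∀ {u} → Walk P u u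
    stepF : ∀ {v} e → P e → Walk P (tgt e) v → Walk P (src e) v
    stepB : ∀ {v} e → P e → Walk P (src e) v → Walk P (tgt e) v

  edgesIn : Subset n → Subset m
  edgesIn S = tabulate (λ e → lookup S (src e) ∧ lookup S (tgt e))

  module _ (w : Fin m → Bool) where
    -- weight w e : true means 1, false means 0.

    E0 : Fin m → Set
    E0 e = w e ≡ false

    inV0 : Fin n → Bool
    inV0 u = any (λ e → not (w e) ∧ incident e u) (allFin m)

    record IsComponent0 (C : Subset n) : Set where
      field
        nonempty  : Nonempty C
        inside    : ∀ u → u ∈ C → inV0 u ≡ true
        connected : ∀ u v → u ∈ C → v ∈ C → Walk E0 u v
        closed    : ∀ u v → u ∈ C → Walk E0 u v → v ∈ C

    record SpanningTreeOf (T : Subset m) (C : Subset n) : Set where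
      field
        spans : ∀ u v → u ∈ C → v ∈ C → Walk (λ e → e ∈ (T ∩ edgesIn C)) u v
        size  : ∣ T ∩ edgesIn C ∣ + 1 ≡ ∣ C ∣

    record IsSpanningForest0 (T : Subset m) : Set where
      field
        weight0 : ∀ e → e ∈ T → E0 e
        trees   : ∀ C → IsComponent0 C → SpanningTreeOf T C

    -- M is a matching in G₁ = (V₁, E₁(V₁)), V₁ = V ∖ V₀.
    record IsMatchingG1 (M : Subset m) : Set where
      field
        inG1 : ∀ e → e ∈ M → (inV0 (src e) ≡ false) × (inV0 (tgt e) ≡ false)
        disjoint : ∀ e e' u → e ∈ M → e' ∈ M →
          incident e u ≡ true → incident e' u ≡ true → e ≡ e'

    record IsMaxMatchingG1 (M : Subset m) : Set where
      field
        matching : IsMatchingG1 M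
        maximum  : ∀ M' → IsMatchingG1 M' → ∣ M' ∣ ≤ ∣ M ∣

    -- Output of ForestCoverBinary for the choices T (= ⋃ Tᵢ) and M.
    -- x_u = 1 iff u ∈ ⋃ Cᵢ (= V₀) or u is covered by M.
    xOut : Subset m → Fin n → ℕ
    xOut M u = if inV0 u ∨ any (λ e → lookup M e ∧ incident e u) (allFin m)
               then 1 else 0

    yOut : Subset m → Subset m → Fin m → ℕ
    yOut T M e = if lookup T e ∨ lookup M e then 1 else 0

  -- Feasibility for the integer program (the objective is irrelevant).
  -- The constraint  Σ_{u∈S} x_u - Σ_{e∈E(S)} y_e ≥ 1  is written over ℕ as
  -- Σ_{u∈S} x_u ≥ 1 + Σ_{e∈E(S)} y_e.
  record Feasible (x : Fin n → ℕ) (y : Fin m → ℕ) : Set where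
    field
      cover    : ∀ e → 1 ≤ x (src e) + x (tgt e)
      linkSrc  : ∀ e → y e ≤ x (src e)
      linkTgt  : ∀ e → y e ≤ x (tgt e)
      subsets  : ∀ (S : Subset n) → Nonempty (edgesIn S) →
        1 + sumFin (λ e → if lookup (edgesIn S) e then y e else 0)
          ≤ sumFin (λ u → if lookup S u then x u else 0)
      xBinary  : ∀ u → (x u ≡ 0) ⊎ (x u ≡ 1)
      yBinary  : ∀ e → (y e ≡ 0) ⊎ (y e ≡ 1)

-- Write X = {u | x_u = 1} = V₀ ∪ V(M) and F = {e | y_e = 1} = T ∪ M.  Every edge meets X,
-- since an edge with both ends outside X could be added to the maximum matching M.  X splits
-- into blocks, the components of G₀ and the edges of M, each spanned by a tree of F-edges, and
-- no F-edge joins two blocks.  A tree has at most |r| - 1 edges inside any nonempty part r of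
-- its vertex set, so summing over the blocks that meet S gives |F ∩ E(S)| + 1 ≤ |X ∩ S| as
-- soon as X ∩ S ≠ ∅, which holds when E(S) ≠ ∅ because X covers every edge.

module Submission where

open import Defs
open import Data.Bool using (Bool; true; false; _∧_; _∨_; not; if_then_else_)
import Data.Bool.Properties as Bool
open import Data.Bool.Properties
  using (∧-conicalˡ; ∧-conicalʳ; ∨-conicalˡ; ∨-conicalʳ; ∧-zeroʳ; ∧-identityʳ; ∨-zeroʳ; ∧-assoc; T-≡)
open import Data.Bool.ListAction using (any)
open import Data.Empty using (⊥; ⊥-elim)
open import Data.Fin using (Fin; zero; suc; _≟_)
open import Data.Fin.Properties using (any?)
open import Data.Fin.Subset using (Subset; _∈_; _∩_; ∣_∣; Nonempty)
open import Data.List using (allFin)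
open import Data.List.Membership.Propositional.Properties using (∈-allFin)
import Data.List.Relation.Unary.Any as Any
open import Data.List.Relation.Unary.Any.Properties using (any⁺; any⁻)
open import Data.Nat using (ℕ; zero; suc; _+_; _≤_; _<_; z≤n; s≤s)
open import Data.Nat.Induction using (<-wellFounded)
open import Data.Nat.Properties
  using (≤-trans; ≤-reflexive; <-irrefl; +-mono-≤; +-monoˡ-≤; +-monoʳ-≤; +-suc; +-comm;
         +-cancelʳ-≤; m≤m+n; m<n+m; +-commutativeSemigroup; module ≤-Reasoning)
open import Algebra.Properties.CommutativeSemigroup +-commutativeSemigroup
  using (x∙yz≈y∙xz; xy∙z≈xz∙y; interchange)
open import Data.Product using (_×_; _,_; proj₁; proj₂; ∃; ∃-syntax)
open import Data.Sum using (_⊎_; inj₁; inj₂; [_,_]′)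
open import Data.Vec using ([]; _∷_; lookup; tabulate)
open import Data.Vec.Properties using (lookup∘tabulate; lookup-zipWith; []=⇒lookup; lookup⇒[]=)
open import Function using (_∘_; Equivalence)
open import Induction.WellFounded using (Acc; acc)
open import Relation.Nullary using (does; yes; no)
open import Relation.Nullary.Decidable using (dec-true; dec-false; decidable-stable; _×-dec_; ¬?)
open import Relation.Binary.PropositionalEquality
  using (_≡_; _≢_; refl; sym; trans; cong; cong₂; subst; module ≡-Reasoning)

iverson : Bool → ℕ
iverson b = if b then 1 else 0

count : ∀ {k} → (Fin k → Bool) → ℕ
count p = sumFin (λ i → iverson (p i))

_⊆ᵇ_ : ∀ {k} → (Fin k → Bool) → (Fin k → Bool) → Set
p ⊆ᵇ q = ∀ i → p i ≡ true → q i ≡ true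

∅ᵇ : ∀ {k} → Fin k → Bool
∅ᵇ _ = false

insert : ∀ {k} → Fin k → (Fin k → Bool) → Fin k → Bool
insert a p i = does (i ≟ a) ∨ p i

insert-here : ∀ {k} (a : Fin k) p → insert a p a ≡ true
insert-here a p rewrite dec-true (a ≟ a) refl = refl

insert-there : ∀ {k} (a : Fin k) p {i} → p i ≡ true → insert a p i ≡ true
insert-there a p pi rewrite pi = ∨-zeroʳ _

insert-elim : ∀ {k} {a : Fin k} {p i} → insert a p i ≡ true → i ≡ a ⊎ p i ≡ true
insert-elim {a = a} {i = i} h with i ≟ a
... | yes i≡a = inj₁ i≡a
... | no _    = inj₂ h

∨-true⁻ : ∀ {x y} → x ∨ y ≡ true → x ≡ true ⊎ y ≡ true
∨-true⁻ {true}  _ = inj₁ refl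
∨-true⁻ {false} y = inj₂ y

not-antitone : ∀ {k} {p q : Fin k → Bool} → p ⊆ᵇ q → (λ i → not (q i)) ⊆ᵇ (λ i → not (p i))
not-antitone {p = p} {q} p⊆q i nq with p i in pi
... | false = refl
... | true  = ⊥-elim (Bool.not-¬ (p⊆q i pi) (Bool.not-injective nq))

∧-antitone : ∀ {k} {p q : Fin k → Bool} (x : Fin k → Bool) → p ⊆ᵇ q →
             (λ i → not (q i) ∧ x i) ⊆ᵇ (λ i → not (p i) ∧ x i)
∧-antitone x p⊆q i h = cong₂ _∧_ (not-antitone p⊆q i (∧-conicalˡ _ _ h)) (∧-conicalʳ _ _ h)

not∧≡false⇒ : ∀ {x y} → not x ∧ y ≡ false → y ≡ true → x ≡ true
not∧≡false⇒ {true}  _  _    = refl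
not∧≡false⇒ {false} () refl

sumFin-cong : ∀ {k} {f g : Fin k → ℕ} → (∀ i → f i ≡ g i) → sumFin f ≡ sumFin g
sumFin-cong {zero}  f≗g = refl
sumFin-cong {suc k} f≗g = cong₂ _+_ (f≗g zero) (sumFin-cong (f≗g ∘ suc))

sumFin-+ : ∀ {k} (f g : Fin k → ℕ) → sumFin (λ i → f i + g i) ≡ sumFin f + sumFin g
sumFin-+ {zero}  f g = refl
sumFin-+ {suc k} f g = trans (cong (f zero + g zero +_) (sumFin-+ (f ∘ suc) (g ∘ suc)))
                             (interchange (f zero) (g zero) _ _)

sumFin-mono-≤ : ∀ {k} {f g : Fin k → ℕ} → (∀ i → f i ≤ g i) → sumFin f ≤ sumFin g
sumFin-mono-≤ {zero}  f≤g = z≤n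
sumFin-mono-≤ {suc k} f≤g = +-mono-≤ (f≤g zero) (sumFin-mono-≤ (f≤g ∘ suc))

iverson-binary : ∀ b → iverson b ≡ 0 ⊎ iverson b ≡ 1
iverson-binary false = inj₁ refl
iverson-binary true  = inj₂ refl

iverson-∨ : ∀ {a b} → a ∨ b ≡ true → 1 ≤ iverson a + iverson b
iverson-∨ {true}         _ = s≤s z≤n
iverson-∨ {false} {true} _ = s≤s z≤n

if-iverson : ∀ a b → (if a then iverson b else 0) ≡ iverson (a ∧ b)
if-iverson true  b = refl
if-iverson false b = refl

iverson-mono : ∀ {a b} → (a ≡ true → b ≡ true) → iverson a ≤ iverson b
iverson-mono {false} _   = z≤n
iverson-mono {true}  a⇒b rewrite a⇒b refl = s≤s z≤n

count-cong : ∀ {k} {p q : Fin k → Bool} → (∀ i → p i ≡ q i) → count p ≡ count q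
count-cong p≗q = sumFin-cong (cong iverson ∘ p≗q)

count-mono : ∀ {k} {p q : Fin k → Bool} → p ⊆ᵇ q → count p ≤ count q
count-mono p⊆q = sumFin-mono-≤ (iverson-mono ∘ p⊆q)

count-none : ∀ {k} {p : Fin k → Bool} → (∀ i → p i ≡ false) → count p ≡ 0
count-none {zero}  _    = refl
count-none {suc k} none rewrite none zero = count-none (none ∘ suc)

witness-or-none : ∀ {k} (p : Fin k → Bool) → (∃ λ i → p i ≡ true) ⊎ (∀ i → p i ≡ false)
witness-or-none p with any? (λ i → p i Bool.≟ true)
... | yes witness = inj₁ witness
... | no  ¬witness = inj₂ (λ i → Bool.¬-not (λ pi → ¬witness (i , pi)))

count-partition : ∀ {k} (q p : Fin k → Bool) →
  count p ≡ count (λ i → q i ∧ p i) + count (λ i → not (q i) ∧ p i)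
count-partition q p = trans (sumFin-cong (λ i → split (q i) (p i)))
  (sumFin-+ (λ i → iverson (q i ∧ p i)) (λ i → iverson (not (q i) ∧ p i)))
  where
  split : ∀ a b → iverson b ≡ iverson (a ∧ b) + iverson (not a ∧ b)
  split true  true  = refl
  split true  false = refl
  split false b     = refl

count-remove : ∀ {k} (p : Fin k → Bool) a →
  count p ≡ iverson (p a) + count (λ i → not (does (i ≟ a)) ∧ p i)
count-remove {suc k} p zero    = refl
count-remove {suc k} p (suc a) =
  trans (cong (iverson (p zero) +_) (count-remove (p ∘ suc) a))
        (x∙yz≈y∙xz (iverson (p zero)) (iverson (p (suc a))) _)

count-pos : ∀ {k} {p : Fin k → Bool} a → p a ≡ true → 0 < count p
count-pos {p = p} a pa rewrite count-remove p a | pa = s≤s z≤n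

count-mono-< : ∀ {k} {p q : Fin k → Bool} a → p ⊆ᵇ q → p a ≡ false → q a ≡ true → count p < count q
count-mono-< {p = p} {q} a p⊆q pa qa rewrite count-remove p a | count-remove q a | pa | qa =
  s≤s (count-mono (λ i h → cong₂ _∧_ (∧-conicalˡ _ _ h) (p⊆q i (∧-conicalʳ _ _ h))))

count-insert : ∀ {k} {p : Fin k → Bool} a → p a ≡ false → count (insert a p) ≡ suc (count p)
count-insert {p = p} a pa
  rewrite count-remove (insert a p) a | insert-here a p | count-remove p a | pa =
  cong suc (count-cong (λ i → absorb (does (i ≟ a)) (p i)))
  where
  absorb : ∀ d x → not d ∧ (d ∨ x) ≡ not d ∧ x
  absorb true  x = refl
  absorb false x = refl

count-singleton : ∀ {k} (a : Fin k) → count (insert a ∅ᵇ) ≡ 1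
count-singleton {k} a = trans (count-insert a refl) (cong suc (count-none {p = ∅ᵇ {k}} (λ _ → refl)))

∣p∣≡count : ∀ {k} (p : Subset k) → ∣ p ∣ ≡ count (lookup p)
∣p∣≡count []          = refl
∣p∣≡count (true  ∷ p) = cong suc (∣p∣≡count p)
∣p∣≡count (false ∷ p) = ∣p∣≡count p

∈-tabulate⁺ : ∀ {k} (p : Fin k → Bool) {i} → p i ≡ true → i ∈ tabulate p
∈-tabulate⁺ p {i} pi = lookup⇒[]= i (tabulate p) (trans (lookup∘tabulate p i) pi)

∈-tabulate⁻ : ∀ {k} (p : Fin k → Bool) {i} → i ∈ tabulate p → p i ≡ true
∈-tabulate⁻ p {i} i∈p = trans (sym (lookup∘tabulate p i)) ([]=⇒lookup i∈p)

any-allFin⁺ : ∀ {k} (p : Fin k → Bool) i → p i ≡ true → any p (allFin k) ≡ true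
any-allFin⁺ p i pi =
  Equivalence.to T-≡ (any⁺ p (Any.map (λ { refl → Equivalence.from T-≡ pi }) (∈-allFin i)))

any-allFin⁻ : ∀ {k} (p : Fin k → Bool) → any p (allFin k) ≡ true → ∃ λ i → p i ≡ true
any-allFin⁻ p h with Any.satisfied (any⁻ p (allFin _) (Equivalence.from T-≡ h))
... | i , pi = i , Equivalence.to T-≡ pi

module _ {G : Graph} where
  open Graph G using (m)

  infixr 5 _++ʷ_

  _++ʷ_ : ∀ {P : Fin m → Set} {a b c} → Walk G P a b → Walk G P b c → Walk G P a c
  here            ++ʷ q = q
  stepF e Pe walk ++ʷ q = stepF e Pe (walk ++ʷ q)
  stepB e Pe walk ++ʷ q = stepB e Pe (walk ++ʷ q)

  reverseʷ : ∀ {P : Fin m → Set} {a b} → Walk G P a b → Walk G P b a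
  reverseʷ here              = here
  reverseʷ (stepF e Pe walk) = reverseʷ walk ++ʷ stepB e Pe here
  reverseʷ (stepB e Pe walk) = reverseʷ walk ++ʷ stepF e Pe here

  mapʷ : ∀ {P Q : Fin m → Set} {a b} → (∀ e → P e → Q e) → Walk G P a b → Walk G Q a b
  mapʷ f here              = here
  mapʷ f (stepF e Pe walk) = stepF e (f e Pe) (mapʷ f walk)
  mapʷ f (stepB e Pe walk) = stepB e (f e Pe) (mapʷ f walk)

module _ (G : Graph) where
  open Graph G using (n; m)

  incident-src : ∀ e → incident G e (src G e) ≡ true
  incident-src e rewrite dec-true (src G e ≟ src G e) refl = refl

  incident-tgt : ∀ e → incident G e (tgt G e) ≡ true
  incident-tgt e rewrite dec-true (tgt G e ≟ tgt G e) refl = ∨-zeroʳ _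

  incident-elim : ∀ {e u} → incident G e u ≡ true → src G e ≡ u ⊎ tgt G e ≡ u
  incident-elim {e} {u} h with src G e ≟ u
  ... | yes src≡u = inj₁ src≡u
  ... | no  _ with tgt G e ≟ u
  ...   | yes tgt≡u = inj₂ tgt≡u

  bothIn : (Fin n → Bool) → Fin m → Bool
  bothIn r e = r (src G e) ∧ r (tgt G e)

  bothIn-mono : ∀ {r r′} → r ⊆ᵇ r′ → bothIn r ⊆ᵇ bothIn r′
  bothIn-mono r⊆r′ e h = cong₂ _∧_ (r⊆r′ _ (∧-conicalˡ _ _ h)) (r⊆r′ _ (∧-conicalʳ _ _ h))

  lookup-edgesIn : ∀ r e → lookup (edgesIn G (tabulate r)) e ≡ bothIn r e
  lookup-edgesIn r e = trans (lookup∘tabulate _ e)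
    (cong₂ _∧_ (lookup∘tabulate r (src G e)) (lookup∘tabulate r (tgt G e)))

  Exit : (Fin n → Bool) → Fin m → Fin n → Set
  Exit r e a = (a ≡ tgt G e × r (src G e) ≡ true) ⊎ (a ≡ src G e × r (tgt G e) ≡ true)

  walk-exit : ∀ {P : Fin m → Set} r {x y} → Walk G P x y → r x ≡ true → r y ≡ false →
              ∃[ e ] ∃[ a ] P e × r a ≡ false × Exit r e a
  walk-exit r here rx ry = ⊥-elim (Bool.not-¬ rx ry)
  walk-exit r (stepF e Pe walk) rx ry with r (tgt G e) in rt
  ... | true  = walk-exit r walk rt ry
  ... | false = e , tgt G e , Pe , rt , inj₁ (refl , rx)
  walk-exit r (stepB e Pe walk) rx ry with r (src G e) in rs
  ... | true  = walk-exit r walk rs ry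
  ... | false = e , src G e , Pe , rs , inj₂ (refl , rx)

  exit-endpoint : ∀ {c r e a} → bothIn c e ≡ true → Exit r e a → c a ≡ true
  exit-endpoint ce (inj₁ (refl , _)) = ∧-conicalʳ _ _ ce
  exit-endpoint ce (inj₂ (refl , _)) = ∧-conicalˡ _ _ ce

  exit-not-bothIn : ∀ {r e a} → r a ≡ false → Exit r e a → bothIn r e ≡ false
  exit-not-bothIn {r} {e} ra (inj₁ (refl , _)) = trans (cong (r (src G e) ∧_) ra) (∧-zeroʳ _)
  exit-not-bothIn {r} {e} ra (inj₂ (refl , _)) = cong (_∧ r (tgt G e)) ra

  exit-bothIn-insert : ∀ {r e a} → Exit r e a → bothIn (insert a r) e ≡ true
  exit-bothIn-insert {r} {e} {a} (inj₁ (refl , rs)) =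
    cong₂ _∧_ (insert-there a r rs) (insert-here a r)
  exit-bothIn-insert {r} {e} {a} (inj₂ (refl , rt)) =
    cong₂ _∧_ (insert-here a r) (insert-there a r rt)

  record IsSpanningTree (c : Fin n → Bool) (b : Fin m → Bool) : Set where
    field
      root    : Fin n
      inside  : b ⊆ᵇ bothIn c
      reaches : ∀ {v} → c v ≡ true → Walk G (λ e → b e ≡ true) root v
      size    : count b + 1 ≡ count c

    leaving : (Fin n → Bool) → ℕ
    leaving r = count (λ e → not (bothIn r e) ∧ b e)

    -- A tree walk from r₀ to a vertex of c outside r exits r along some edge; adding
    -- that edge's outer endpoint to r makes the edge internal.
    cut-bound : ∀ {r r₀} → r ⊆ᵇ c → r r₀ ≡ true → count c ≤ count r + leaving r
    cut-bound {r₀ = r₀} r⊆c r₀∈r = go r⊆c r₀∈r (<-wellFounded _)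
      where
      go : ∀ {r} → r ⊆ᵇ c → r r₀ ≡ true → Acc _<_ (count (λ v → not (r v) ∧ c v)) →
           count c ≤ count r + leaving r
      go {r} r⊆c r₀∈r (acc smaller) with witness-or-none (λ v → not (r v) ∧ c v)
      ... | inj₂ c⊆r = ≤-trans (count-mono (λ v → not∧≡false⇒ (c⊆r v))) (m≤m+n _ _)
      ... | inj₁ (v , v∈c∖r)
        with walk-exit r (reverseʷ (reaches (r⊆c r₀ r₀∈r)) ++ʷ reaches (∧-conicalʳ _ _ v∈c∖r)) r₀∈r
                         (Bool.not-injective (∧-conicalˡ _ _ v∈c∖r))
      ...   | e , a , e∈b , a∉r , e-exits = begin
        count c                      ≤⟨ go r′⊆c (insert-there a r r₀∈r) (smaller fewer-vertices) ⟩
        count r′ + leaving r′        ≡⟨ cong (_+ leaving r′) (count-insert a a∉r) ⟩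
        suc (count r + leaving r′)   ≡⟨ +-suc _ _ ⟨
        count r + suc (leaving r′)   ≤⟨ +-monoʳ-≤ (count r) fewer-edges ⟩
        count r + leaving r          ∎
        where
        open ≤-Reasoning
        r′ = insert a r

        a∈c : c a ≡ true
        a∈c = exit-endpoint {c} {r} (inside e e∈b) e-exits

        r⊆r′ : r ⊆ᵇ r′
        r⊆r′ _ = insert-there a r

        r′⊆c : r′ ⊆ᵇ c
        r′⊆c u h = [ (λ { refl → a∈c }) , r⊆c u ]′ (insert-elim {a = a} {p = r} h)

        fewer-vertices : count (λ v → not (r′ v) ∧ c v) < count (λ v → not (r v) ∧ c v)
        fewer-vertices = count-mono-< a (∧-antitone c r⊆r′)
          (cong (λ x → not x ∧ c a) (insert-here a r)) (cong₂ _∧_ (cong not a∉r) a∈c)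

        fewer-edges : leaving r′ < leaving r
        fewer-edges = count-mono-< e (∧-antitone b (bothIn-mono r⊆r′))
          (cong (λ x → not x ∧ b e) (exit-bothIn-insert {r} e-exits))
          (cong₂ _∧_ (cong not (exit-not-bothIn {r} a∉r e-exits)) e∈b)

    induced-edges : ∀ {r r₀} → r ⊆ᵇ c → r r₀ ≡ true → count (λ e → bothIn r e ∧ b e) + 1 ≤ count r
    induced-edges {r} r⊆c r₀∈r = +-cancelʳ-≤ (leaving r) _ _ (begin
      internal + 1 + leaving r ≡⟨ xy∙z≈xz∙y internal 1 (leaving r) ⟩
      internal + leaving r + 1 ≡⟨ cong (_+ 1) (count-partition (bothIn r) b) ⟨
      count b + 1              ≡⟨ size ⟩
      count c                  ≤⟨ cut-bound r⊆c r₀∈r ⟩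
      count r + leaving r      ∎)
      where
      open ≤-Reasoning
      internal = count (λ e → bothIn r e ∧ b e)

module _ (G : Graph) (w : Fin (Graph.m G) → Bool) where
  open Graph G using (n; m)

  inV0-src : ∀ {e} → E0 G w e → inV0 G w (src G e) ≡ true
  inV0-src {e} e∈E₀ = any-allFin⁺ _ e (cong₂ _∧_ (cong not e∈E₀) (incident-src G e))

  inV0-tgt : ∀ {e} → E0 G w e → inV0 G w (tgt G e) ≡ true
  inV0-tgt {e} e∈E₀ = any-allFin⁺ _ e (cong₂ _∧_ (cong not e∈E₀) (incident-tgt G e))

  walk-inV0 : ∀ {x y} → Walk G (E0 G w) x y → inV0 G w x ≡ true → inV0 G w y ≡ true
  walk-inV0 here                   x∈V₀ = x∈V₀
  walk-inV0 (stepF e e∈E₀ walk) _ = walk-inV0 walk (inV0-tgt e∈E₀)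
  walk-inV0 (stepB e e∈E₀ walk) _ = walk-inV0 walk (inV0-src e∈E₀)

  record Component (u : Fin n) : Set where
    field
      member    : Fin n → Bool
      root      : member u ≡ true
      reachable : ∀ {v} → member v ≡ true → Walk G (E0 G w) u v
      closed    : ∀ e → E0 G w e → member (src G e) ≡ member (tgt G e)

    walk-closed : ∀ {x y} → Walk G (E0 G w) x y → member x ≡ true → member y ≡ true
    walk-closed here                x∈C = x∈C
    walk-closed (stepF e e∈E₀ walk) x∈C = walk-closed walk (trans (sym (closed e e∈E₀)) x∈C)
    walk-closed (stepB e e∈E₀ walk) x∈C = walk-closed walk (trans (closed e e∈E₀) x∈C)

    member⊆V₀ : inV0 G w u ≡ true → member ⊆ᵇ inV0 G w
    member⊆V₀ u∈V₀ v v∈C = walk-inV0 (reachable v∈C) u∈V₀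

    isComponent0 : inV0 G w u ≡ true → IsComponent0 G w (tabulate member)
    isComponent0 u∈V₀ = record
      { nonempty  = u , ∈-tabulate⁺ member root
      ; inside    = λ v v∈C → member⊆V₀ u∈V₀ v (∈-tabulate⁻ member v∈C)
      ; connected = λ x y x∈C y∈C →
          reverseʷ (reachable (∈-tabulate⁻ member x∈C)) ++ʷ reachable (∈-tabulate⁻ member y∈C)
      ; closed    = λ x y x∈C walk →
          ∈-tabulate⁺ member (walk-closed walk (∈-tabulate⁻ member x∈C))
      }

  -- The hypothesis on T speaks only about components given as vertex sets, so the component
  -- of u is computed: grow a reachable set until no weight-0 edge leaves it.
  component : ∀ u → Component u
  component u = grow (insert u ∅ᵇ) (insert-here u ∅ᵇ) reaches-u (<-wellFounded _)
    where
    reaches-u : ∀ {v} → insert u ∅ᵇ v ≡ true → Walk G (E0 G w) u v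
    reaches-u {v} h with insert-elim {a = u} {p = ∅ᵇ} {i = v} h
    ... | inj₁ refl = here

    Reach : (Fin n → Bool) → Set
    Reach r = ∀ {v} → r v ≡ true → Walk G (E0 G w) u v

    new-vertex : ∀ r → Reach r → ∀ e → E0 G w e → r (src G e) ≢ r (tgt G e) →
                 ∃ λ a → r a ≡ false × Walk G (E0 G w) u a
    new-vertex r reach e e∈E₀ differ with r (src G e) in rs | r (tgt G e) in rt
    ... | true  | true  = ⊥-elim (differ refl)
    ... | false | false = ⊥-elim (differ refl)
    ... | true  | false = tgt G e , rt , reach rs ++ʷ stepF e e∈E₀ here
    ... | false | true  = src G e , rs , reach rt ++ʷ stepB e e∈E₀ here

    grow : ∀ r → r u ≡ true → Reach r → Acc _<_ (count (λ v → not (r v))) → Component u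
    grow r u∈r reach (acc smaller)
      with any? (λ e → (w e Bool.≟ false) ×-dec ¬? (r (src G e) Bool.≟ r (tgt G e)))
    ... | no ¬leaving = record
      { member = r ; root = u∈r ; reachable = reach
      ; closed = λ e e∈E₀ →
          decidable-stable (r (src G e) Bool.≟ r (tgt G e))
            (λ differ → ¬leaving (e , e∈E₀ , differ)) }
    ... | yes (e , e∈E₀ , differ) with new-vertex r reach e e∈E₀ differ
    ...   | a , a∉r , walk = grow (insert a r) (insert-there a r u∈r) reach′ (smaller fewer)
      where
      reach′ : Reach (insert a r)
      reach′ h = [ (λ { refl → walk }) , reach ]′ (insert-elim {p = r} h)
      fewer : count (λ v → not (insert a r v)) < count (λ v → not (r v))
      fewer = count-mono-< a (not-antitone (λ _ → insert-there a r))
                (cong not (insert-here a r)) (cong not a∉r)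

module ForestCover (G : Graph) (w : Fin (Graph.m G) → Bool) (T M : Subset (Graph.m G))
                   (hT : IsSpanningForest0 G w T) (hM : IsMaxMatchingG1 G w M) where
  open Graph G using (n; m; noLoop)
  open IsMatchingG1 (IsMaxMatchingG1.matching hM)

  matched : Fin n → Bool
  matched u = any (λ e → lookup M e ∧ incident G e u) (allFin m)

  X : Fin n → Bool
  X u = inV0 G w u ∨ matched u

  F : Fin m → Bool
  F e = lookup T e ∨ lookup M e

  T⇒E0 : ∀ {e} → lookup T e ≡ true → E0 G w e
  T⇒E0 {e} e∈T = IsSpanningForest0.weight0 hT e (lookup⇒[]= e T e∈T)

  M⇒outsideV₀ : ∀ {e} → lookup M e ≡ true →
                inV0 G w (src G e) ≡ false × inV0 G w (tgt G e) ≡ false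
  M⇒outsideV₀ {e} e∈M = inG1 e (lookup⇒[]= e M e∈M)

  M-disjoint : ∀ {e e′ u} → lookup M e ≡ true → lookup M e′ ≡ true →
               incident G e u ≡ true → incident G e′ u ≡ true → e ≡ e′
  M-disjoint {e} {e′} {u} e∈M e′∈M = disjoint e e′ u (lookup⇒[]= e M e∈M) (lookup⇒[]= e′ M e′∈M)

  matched-intro : ∀ {e u} → lookup M e ≡ true → incident G e u ≡ true → matched u ≡ true
  matched-intro {e} e∈M e∋u = any-allFin⁺ _ e (cong₂ _∧_ e∈M e∋u)

  unmatched : ∀ {e u} → matched u ≡ false → lookup M e ≡ true → incident G e u ≡ true → ⊥
  unmatched u∉M e∈M e∋u = Bool.not-¬ (matched-intro e∈M e∋u) u∉M

  X-V₀ : ∀ {u} → inV0 G w u ≡ true → X u ≡ true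
  X-V₀ u∈V₀ rewrite u∈V₀ = refl

  X-matched : ∀ {u} → matched u ≡ true → X u ≡ true
  X-matched u∈M rewrite u∈M = ∨-zeroʳ _

  F⇒X-src : ∀ e → F e ≡ true → X (src G e) ≡ true
  F⇒X-src e e∈F with lookup T e in e∈T
  ... | true  = X-V₀ (inV0-src G w (T⇒E0 e∈T))
  ... | false = X-matched (matched-intro e∈F (incident-src G e))

  F⇒X-tgt : ∀ e → F e ≡ true → X (tgt G e) ≡ true
  F⇒X-tgt e e∈F with lookup T e in e∈T
  ... | true  = X-V₀ (inV0-tgt G w (T⇒E0 e∈T))
  ... | false = X-matched (matched-intro e∈F (incident-tgt G e))

  F∩E : (Fin n → Bool) → Fin m → Bool
  F∩E s e = bothIn G s e ∧ F e

  X∩ : (Fin n → Bool) → Fin n → Bool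
  X∩ s v = s v ∧ X v

  F∩E-empty : ∀ {s} → (∀ v → X∩ s v ≡ false) → count (F∩E s) ≡ 0
  F∩E-empty {s} none = count-none λ e → Bool.¬-not λ e∈F∩E →
    Bool.not-¬ (cong₂ _∧_ (∧-conicalˡ _ _ (∧-conicalˡ _ _ e∈F∩E)) (F⇒X-src e (∧-conicalʳ _ _ e∈F∩E)))
               (none (src G e))

  record Block (u : Fin n) : Set where
    field
      vertices   : Fin n → Bool
      ∋u         : vertices u ≡ true
      ⊆X         : vertices ⊆ᵇ X
      F-closed   : ∀ e → F e ≡ true → vertices (src G e) ≡ vertices (tgt G e)
      tree-edges : Fin m → Bool
      is-tree    : IsSpanningTree G vertices tree-edges
      F-inside   : F∩E vertices ⊆ᵇ tree-edges

    within beyond : (Fin n → Bool) → Fin n → Bool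
    within s v = vertices v ∧ s v
    beyond s v = not (vertices v) ∧ s v

    X∩-split : ∀ s → count (X∩ s) ≡ count (within s) + count (X∩ (beyond s))
    X∩-split s = trans (count-partition vertices (X∩ s))
      (cong₂ _+_ (count-cong λ v → absorb (vertices v) (s v) (X v) (⊆X v))
                 (count-cong λ v → sym (∧-assoc (not (vertices v)) (s v) (X v))))
      where
      absorb : ∀ c x y → (c ≡ true → y ≡ true) → c ∧ (x ∧ y) ≡ c ∧ x
      absorb false x y _   = refl
      absorb true  x y c⇒y rewrite c⇒y refl = ∧-identityʳ x

    F∩E-split : ∀ s → count (F∩E s) ≡ count (F∩E (within s)) + count (F∩E (beyond s))
    F∩E-split s = trans (count-partition (vertices ∘ src G) (F∩E s))
      (cong₂ _+_ (count-cong λ e → restrict (F e) (F-closed e))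
                 (count-cong λ e → restrict (F e) (cong not ∘ F-closed e)))
      where
      restrict : ∀ {q q′ a b} f → (f ≡ true → q ≡ q′) → q ∧ ((a ∧ b) ∧ f) ≡ ((q ∧ a) ∧ (q′ ∧ b)) ∧ f
      restrict {q} {q′} {a} {b} false _ =
        trans (cong (q ∧_) (∧-zeroʳ (a ∧ b))) (trans (∧-zeroʳ q) (sym (∧-zeroʳ _)))
      restrict {false} true _    = refl
      restrict {true}  true q≡q′ rewrite sym (q≡q′ refl) = refl

    local-bound : ∀ {s} → s u ≡ true → count (F∩E (within s)) + 1 ≤ count (within s)
    local-bound {s} u∈s = ≤-trans (+-monoˡ-≤ 1 (count-mono F-edges⊆tree))
      (IsSpanningTree.induced-edges is-tree within⊆ (cong₂ _∧_ ∋u u∈s))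
      where
      within⊆ : within s ⊆ᵇ vertices
      within⊆ v = ∧-conicalˡ (vertices v) (s v)
      F-edges⊆tree : F∩E (within s) ⊆ᵇ (λ e → bothIn G (within s) e ∧ tree-edges e)
      F-edges⊆tree e h = cong₂ _∧_ e∈E
        (F-inside e (cong₂ _∧_ (bothIn-mono G within⊆ e e∈E) (∧-conicalʳ _ _ h)))
        where
        e∈E : bothIn G (within s) e ≡ true
        e∈E = ∧-conicalˡ _ (F e) h

  block-V₀ : ∀ {u} → inV0 G w u ≡ true → Block u
  block-V₀ {u} u∈V₀ = record
    { vertices = member ; ∋u = root ; ⊆X = λ v → X-V₀ ∘ member⊆V₀ u∈V₀ v ; F-closed = F-closed
    ; tree-edges = lookup (T ∩ edgesIn G C) ; is-tree = is-tree ; F-inside = F-inside }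
    where
    open Component (component G w u)
    C = tabulate member

    tree : SpanningTreeOf G w T C
    tree = IsSpanningForest0.trees hT C (isComponent0 u∈V₀)

    lookup-tree : ∀ e → lookup (T ∩ edgesIn G C) e ≡ lookup T e ∧ bothIn G member e
    lookup-tree e = trans (lookup-zipWith _∧_ e T (edgesIn G C))
                          (cong (lookup T e ∧_) (lookup-edgesIn G member e))

    member-inV0 : ∀ {v} → member v ≡ true → inV0 G w v ≡ true
    member-inV0 = member⊆V₀ u∈V₀ _

    outside : ∀ {v} → inV0 G w v ≡ false → member v ≡ false
    outside v∉V₀ = Bool.¬-not (λ v∈C → Bool.not-¬ (member-inV0 v∈C) v∉V₀)

    F-closed : ∀ e → F e ≡ true → member (src G e) ≡ member (tgt G e)
    F-closed e e∈F with lookup T e in e∈T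
    ... | true  = closed e (T⇒E0 e∈T)
    ... | false = trans (outside (proj₁ (M⇒outsideV₀ e∈F)))
                        (sym (outside (proj₂ (M⇒outsideV₀ e∈F))))

    is-tree : IsSpanningTree G member (lookup (T ∩ edgesIn G C))
    is-tree = record
      { root    = u
      ; inside  = λ e h → ∧-conicalʳ (lookup T e) _ (trans (sym (lookup-tree e)) h)
      ; reaches = λ v∈C → mapʷ (λ e → []=⇒lookup)
                    (SpanningTreeOf.spans tree u _ (∈-tabulate⁺ member root) (∈-tabulate⁺ member v∈C))
      ; size    = begin
          count (lookup (T ∩ edgesIn G C)) + 1 ≡⟨ cong (_+ 1) (∣p∣≡count (T ∩ edgesIn G C)) ⟨
          ∣ T ∩ edgesIn G C ∣ + 1             ≡⟨ SpanningTreeOf.size tree ⟩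
          ∣ C ∣                               ≡⟨ ∣p∣≡count C ⟩
          count (lookup C)                    ≡⟨ count-cong (lookup∘tabulate member) ⟩
          count member                        ∎
      }
      where open ≡-Reasoning

    F-inside : F∩E member ⊆ᵇ lookup (T ∩ edgesIn G C)
    F-inside e h with lookup T e in e∈T
    ... | true  = trans (lookup-tree e) (cong₂ _∧_ e∈T (∧-conicalˡ _ _ h))
    ... | false = ⊥-elim (Bool.not-¬ (member-inV0 (∧-conicalˡ _ _ (∧-conicalˡ _ _ h)))
                                     (proj₁ (M⇒outsideV₀ (∧-conicalʳ _ _ h))))

  block-matched : ∀ {u} → matched u ≡ true → Block u
  block-matched {u} u∈M = record
    { vertices = c ; ∋u = ∋u ; ⊆X = λ v → X-matched ∘ matched-intro e₀∈M ∘ e₀∋c ; F-closed = F-closed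
    ; tree-edges = insert e₀ ∅ᵇ ; is-tree = is-tree ; F-inside = F-inside }
    where
    witness = any-allFin⁻ _ u∈M
    e₀ = proj₁ witness
    s₀ = src G e₀
    t₀ = tgt G e₀

    e₀∈M : lookup M e₀ ≡ true
    e₀∈M = ∧-conicalˡ _ _ (proj₂ witness)

    c : Fin n → Bool
    c = insert s₀ (insert t₀ ∅ᵇ)

    s₀∈c : c s₀ ≡ true
    s₀∈c = insert-here s₀ (insert t₀ ∅ᵇ)

    t₀∈c : c t₀ ≡ true
    t₀∈c = insert-there s₀ (insert t₀ ∅ᵇ) {t₀} (insert-here t₀ ∅ᵇ)

    c-elim : ∀ {v} → c v ≡ true → v ≡ s₀ ⊎ v ≡ t₀
    c-elim {v} h with insert-elim {a = s₀} {p = insert t₀ ∅ᵇ} {i = v} h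
    ... | inj₁ v≡s₀ = inj₁ v≡s₀
    ... | inj₂ h′ with insert-elim {a = t₀} {p = ∅ᵇ} {i = v} h′
    ...   | inj₁ v≡t₀ = inj₂ v≡t₀

    e₀∋c : ∀ {v} → c v ≡ true → incident G e₀ v ≡ true
    e₀∋c {v} h with c-elim {v} h
    ... | inj₁ refl = incident-src G e₀
    ... | inj₂ refl = incident-tgt G e₀

    outside : ∀ {v} → inV0 G w v ≡ true → c v ≡ false
    outside v∈V₀ = Bool.¬-not λ v∈c → Bool.not-¬ v∈V₀ (c-outsideV₀ v∈c)
      where
      c-outsideV₀ : ∀ {v} → c v ≡ true → inV0 G w v ≡ false
      c-outsideV₀ {v} h with c-elim {v} h
      ... | inj₁ refl = proj₁ (M⇒outsideV₀ e₀∈M)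
      ... | inj₂ refl = proj₂ (M⇒outsideV₀ e₀∈M)

    touches : ∀ {e v} → lookup M e ≡ true → incident G e v ≡ true → c v ≡ true → e ≡ e₀
    touches e∈M e∋v v∈c = M-disjoint e∈M e₀∈M e∋v (e₀∋c v∈c)

    ∋u : c u ≡ true
    ∋u = [ (λ s₀≡u → subst (λ v → c v ≡ true) s₀≡u s₀∈c)
         , (λ t₀≡u → subst (λ v → c v ≡ true) t₀≡u t₀∈c) ]′
           (incident-elim G (∧-conicalʳ _ _ (proj₂ witness)))

    F-closed : ∀ e → F e ≡ true → c (src G e) ≡ c (tgt G e)
    F-closed e e∈F with lookup T e in e∈T
    ... | true = trans (outside (inV0-src G w (T⇒E0 e∈T))) (sym (outside (inV0-tgt G w (T⇒E0 e∈T))))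
    ... | false with e ≟ e₀
    ...   | yes refl = trans s₀∈c (sym t₀∈c)
    ...   | no  e≢e₀ = trans (Bool.¬-not (e≢e₀ ∘ touches e∈F (incident-src G e)))
                             (sym (Bool.¬-not (e≢e₀ ∘ touches e∈F (incident-tgt G e))))

    is-tree : IsSpanningTree G c (insert e₀ ∅ᵇ)
    is-tree = record
      { root    = s₀
      ; inside  = inside
      ; reaches = reaches
      ; size    = begin
          count (insert e₀ ∅ᵇ) + 1   ≡⟨ cong (_+ 1) (count-singleton e₀) ⟩
          2                          ≡⟨ cong suc (count-singleton t₀) ⟨
          suc (count (insert t₀ ∅ᵇ)) ≡⟨ count-insert s₀ s₀≢t₀ ⟨
          count c                    ∎
      }
      where
      open ≡-Reasoning
      s₀≢t₀ : insert t₀ ∅ᵇ s₀ ≡ false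
      s₀≢t₀ = cong (_∨ false) (dec-false (s₀ ≟ t₀) (noLoop e₀))
      inside : insert e₀ ∅ᵇ ⊆ᵇ bothIn G c
      inside e h with insert-elim {a = e₀} {p = ∅ᵇ} {i = e} h
      ... | inj₁ refl = cong₂ _∧_ s₀∈c t₀∈c
      reaches : ∀ {v} → c v ≡ true → Walk G (λ e → insert e₀ ∅ᵇ e ≡ true) s₀ v
      reaches {v} h with c-elim {v} h
      ... | inj₁ refl = here
      ... | inj₂ refl = stepF e₀ (insert-here e₀ ∅ᵇ) here

    F-inside : F∩E c ⊆ᵇ insert e₀ ∅ᵇ
    F-inside e h with lookup T e in e∈T
    ... | true  = ⊥-elim (Bool.not-¬ (∧-conicalˡ _ _ (∧-conicalˡ _ _ h))
                                     (outside (inV0-src G w (T⇒E0 e∈T))))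
    ... | false = subst (λ e → insert e₀ ∅ᵇ e ≡ true)
                    (sym (touches (∧-conicalʳ _ _ h) (incident-src G e) (∧-conicalˡ _ _ (∧-conicalˡ _ _ h))))
                    (insert-here e₀ ∅ᵇ)

  block : ∀ {u} → X u ≡ true → Block u
  block {u} u∈X with inV0 G w u in u∈V₀
  ... | true  = block-V₀ u∈V₀
  ... | false = block-matched u∈X

  forest-bound : ∀ s {u} → s u ≡ true → X u ≡ true → count (F∩E s) + 1 ≤ count (X∩ s)
  forest-bound s u∈s u∈X = go s u∈s u∈X (<-wellFounded _)
    where
    go : ∀ s {u} → s u ≡ true → X u ≡ true → Acc _<_ (count (X∩ s)) →
         count (F∩E s) + 1 ≤ count (X∩ s)
    go s {u} u∈s u∈X (acc smaller) = begin
      count (F∩E s) + 1                                   ≡⟨ cong (_+ 1) (F∩E-split s) ⟩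
      count (F∩E (within s)) + count (F∩E (beyond s)) + 1 ≡⟨ xy∙z≈xz∙y (count (F∩E (within s))) _ 1 ⟩
      count (F∩E (within s)) + 1 + count (F∩E (beyond s)) ≤⟨ +-mono-≤ (local-bound u∈s) rest ⟩
      count (within s) + count (X∩ (beyond s))            ≡⟨ X∩-split s ⟨
      count (X∩ s)                                        ∎
      where
      open ≤-Reasoning
      open Block (block u∈X)
      rest : count (F∩E (beyond s)) ≤ count (X∩ (beyond s))
      rest with witness-or-none (X∩ (beyond s))
      ... | inj₂ none        = ≤-trans (≤-reflexive (F∩E-empty none)) z≤n
      ... | inj₁ (v , v∈X∩) = ≤-trans (m≤m+n _ 1)
        (go (beyond s) (∧-conicalˡ _ _ v∈X∩) (∧-conicalʳ _ _ v∈X∩) (smaller fewer))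
        where
        fewer : count (X∩ (beyond s)) < count (X∩ s)
        fewer = subst (count (X∩ (beyond s)) <_) (sym (X∩-split s))
                      (m<n+m _ (count-pos u (cong₂ _∧_ ∋u u∈s)))

  no-augmenting-edge : ∀ e → X (src G e) ≡ false → X (tgt G e) ≡ false → ⊥
  no-augmenting-edge e s∉X t∉X = <-irrefl refl (begin-strict
    ∣ M ∣                      ≡⟨ ∣p∣≡count M ⟩
    count (lookup M)           <⟨ ≤-reflexive (sym (count-insert e e∉M)) ⟩
    count (insert e (lookup M)) ≡⟨ count-cong (lookup∘tabulate (insert e (lookup M))) ⟨
    count (lookup M′)          ≡⟨ ∣p∣≡count M′ ⟨
    ∣ M′ ∣                     ≤⟨ IsMaxMatchingG1.maximum hM M′ M′-matching ⟩
    ∣ M ∣                      ∎)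
    where
    open ≤-Reasoning
    M′ = tabulate (insert e (lookup M))

    endpoint-unmatched : ∀ {v} → incident G e v ≡ true → matched v ≡ false
    endpoint-unmatched e∋v with incident-elim G e∋v
    ... | inj₁ refl = ∨-conicalʳ _ _ s∉X
    ... | inj₂ refl = ∨-conicalʳ _ _ t∉X

    e∉M : lookup M e ≡ false
    e∉M = Bool.¬-not λ e∈M → unmatched (endpoint-unmatched (incident-src G e)) e∈M (incident-src G e)

    M′-elim : ∀ {e′} → e′ ∈ M′ → e′ ≡ e ⊎ lookup M e′ ≡ true
    M′-elim {e′} e′∈M′ = insert-elim {a = e} {p = lookup M} {i = e′} (∈-tabulate⁻ _ e′∈M′)

    M′-matching : IsMatchingG1 G w M′
    M′-matching = record { inG1 = inG1′ ; disjoint = disjoint′ }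
      where
      inG1′ : ∀ e′ → e′ ∈ M′ → inV0 G w (src G e′) ≡ false × inV0 G w (tgt G e′) ≡ false
      inG1′ e′ e′∈M′ with M′-elim e′∈M′
      ... | inj₁ refl = ∨-conicalˡ _ _ s∉X , ∨-conicalˡ _ _ t∉X
      ... | inj₂ e′∈M = M⇒outsideV₀ e′∈M
      disjoint′ : ∀ e₁ e₂ v → e₁ ∈ M′ → e₂ ∈ M′ →
                  incident G e₁ v ≡ true → incident G e₂ v ≡ true → e₁ ≡ e₂
      disjoint′ e₁ e₂ v e₁∈M′ e₂∈M′ e₁∋v e₂∋v with M′-elim e₁∈M′ | M′-elim e₂∈M′
      ... | inj₁ refl | inj₁ refl = refl
      ... | inj₁ refl | inj₂ e₂∈M = ⊥-elim (unmatched (endpoint-unmatched e₁∋v) e₂∈M e₂∋v)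
      ... | inj₂ e₁∈M | inj₁ refl = ⊥-elim (unmatched (endpoint-unmatched e₂∋v) e₁∈M e₁∋v)
      ... | inj₂ e₁∈M | inj₂ e₂∈M = M-disjoint e₁∈M e₂∈M e₁∋v e₂∋v

  covered : ∀ e → X (src G e) ∨ X (tgt G e) ≡ true
  covered e with X (src G e) in s∈X | X (tgt G e) in t∈X
  ... | true  | _     = refl
  ... | false | true  = refl
  ... | false | false = ⊥-elim (no-augmenting-edge e s∈X t∈X)

  subset-bound : ∀ S → Nonempty (edgesIn G S) →
    1 + sumFin (λ e → if lookup (edgesIn G S) e then iverson (F e) else 0)
      ≤ sumFin (λ u → if lookup S u then iverson (X u) else 0)
  subset-bound S (e₀ , e₀∈E[S]) = begin
    1 + sumFin (λ e → if lookup (edgesIn G S) e then iverson (F e) else 0)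
      ≡⟨ cong suc (sumFin-cong λ e → trans (if-iverson (lookup (edgesIn G S) e) (F e))
                                           (cong (λ b → iverson (b ∧ F e)) (lookup∘tabulate _ e))) ⟩
    1 + count (F∩E s)
      ≡⟨ +-comm 1 _ ⟩
    count (F∩E s) + 1
      ≤⟨ one-more-vertex ⟩
    count (X∩ s)
      ≡⟨ sumFin-cong (λ u → if-iverson (s u) (X u)) ⟨
    sumFin (λ u → if lookup S u then iverson (X u) else 0) ∎
    where
    open ≤-Reasoning
    s = lookup S
    e₀∈s : bothIn G s e₀ ≡ true
    e₀∈s = ∈-tabulate⁻ _ e₀∈E[S]
    one-more-vertex : count (F∩E s) + 1 ≤ count (X∩ s)
    one-more-vertex with ∨-true⁻ (covered e₀)
    ... | inj₁ s₀∈X = forest-bound s (∧-conicalˡ _ _ e₀∈s) s₀∈X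
    ... | inj₂ t₀∈X = forest-bound s (∧-conicalʳ _ _ e₀∈s) t₀∈X

lemma3 : (G : Graph) (w : Fin (Graph.m G) → Bool)
    (T : Subset (Graph.m G)) (M : Subset (Graph.m G)) →
    IsSpanningForest0 G w T → IsMaxMatchingG1 G w M →
    Feasible G (xOut G w M) (yOut G w T M)
lemma3 G w T M hT hM = record
  { cover   = λ e → iverson-∨ {X (src G e)} (covered e)
  ; linkSrc = λ e → iverson-mono (F⇒X-src e)
  ; linkTgt = λ e → iverson-mono (F⇒X-tgt e)
  ; subsets = subset-bound
  ; xBinary = λ u → iverson-binary (X u)
  ; yBinary = λ e → iverson-binary (F e)
  }
  where open ForestCover G w T M hT hM
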